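{- Let $\mathbb{F}_q$ be the finite field with $q$ elements, $d\ge2$, $t\in\mathbb{F}_q\setminus\{0\}$, $E\subseteq\mathbb{F}_q^d$. For every integer $k\ge1$, $$\mathcal{P}_{2k+1}=q^{ -1}\mathcal{P}_k^2+R_{2k+1},\qquad \mathcal{P}_{2k}=q^{ -1}\mathcal{P}_k\mathcal{P}_{k-1}+R_{2k},$$ where $$|R_{2k+1}|\le q^{\frac{d-1}{2}}\mathcal{P}_{2k},\qquad |R_{2k}|\le q^{\frac{d-1}{2}}\sqrt{\mathcal{P}_{2k}\mathcal{P}_{2k-2}}.$$
   Context: For $k\ge0$, $\mathcal{P}_k$ is the number of paths of length $k$ in the dot-product graph on $E$, i.e. the number of $(k+1)$-tuples $(x_0,\dots,x_k)\in E^{k+1}$ with $x_{i-1}\cdot x_i=t$ for $1\le i\le k$, where $x\cdot y=\sum_{j=1}^d x_jy_j$ (vertices not required distinct); in particular $\mathcal{P}_0=|E|$. -}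

module Defs where

open import Level using (0ℓ)
open import Algebra.Bundles using (CommutativeRing)
open import Data.Bool using (Bool; true; false; _∧_; if_then_else_)
open import Data.Nat using (ℕ; zero; suc)
open import Data.List using (List; []; _∷_; [_]; map; concatMap; filter; length)
open import Data.List.Membership.Propositional using (_∈_)
open import Data.List.Relation.Unary.Unique.Propositional using (Unique)
open import Data.Vec using (Vec; []; _∷_; zipWith; foldr)
open import Data.Product using (∃)
open import Relation.Nullary using (¬_; does)
open import Relation.Binary.Definitions using (DecidableEquality)
open import Relation.Binary.PropositionalEquality using (_≡_)
open import Relation.Unary using (Pred)

record FiniteField : Set₁ where
  field
    cring    : CommutativeRing 0ℓ 0ℓ
  open CommutativeRing cring public
  field
    ≈⇒≡      : ∀ {x y} → x ≈ y → x ≡ y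
    _≟_      : DecidableEquality Carrier
    1≢0      : ¬ (1# ≡ 0#)
    inverse  : ∀ x → ¬ (x ≡ 0#) → ∃ λ y → x * y ≡ 1#
    elems    : List Carrier
    unique   : Unique elems
    complete : ∀ x → x ∈ elems

  order : ℕ
  order = length elems

module _ (F : FiniteField) where
  open FiniteField F

  Point : ℕ → Set
  Point d = Vec Carrier d

  allVecs : {A : Set} → List A → (n : ℕ) → List (Vec A n)
  allVecs xs zero    = [ [] ]
  allVecs xs (suc n) = concatMap (λ x → map (x ∷_) (allVecs xs n)) xs

  dot : ∀ {d} → Point d → Point d → Carrier
  dot x y = foldr _ _+_ 0# (zipWith _*_ x y)

  isPath : ∀ {d} → Carrier → ∀ {n} → Vec (Point d) n → Bool
  isPath t []                = true
  isPath t (x ∷ [])          = true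
  isPath t (x ∷ (y ∷ ys))    = does (dot x y ≟ t) ∧ isPath t (y ∷ ys)

  points : ∀ d → (Point d → Bool) → List (Point d)
  points d E = filter (λ x → E x ≟B true) (allVecs elems d)
    where
    open import Data.Bool.Properties using () renaming (_≟_ to _≟B_)

  𝒫 : ∀ d → (E : Point d → Bool) → Carrier → ℕ → ℕ
  𝒫 d E t k = length (filter (λ xs → isPath t xs ≟B true) (allVecs (points d E) (suc k)))
    where
    open import Data.Bool.Properties using () renaming (_≟_ to _≟B_)

module Submission where

-- Write u_k(x) for the number of paths of length k in E starting at x (zero for x ∉ E), and
-- A_a w (x) = Σ_{x·y = a} w(y).  Then Σ_x u_a(x) u_b(x) = 𝒫_{a+b} and u_{b+1} = 1_E · A_t u_b, so
-- q 𝒫_{a+b+1} − 𝒫_a 𝒫_b = Σ_x u_a(x) (q A_t u_b(x) − Σ u_b), and by Cauchy–Schwarz its square is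
-- at most 𝒫_{2a} ‖q A_t u_b − Σ u_b‖².  Rescaling x shows that ‖q A_a w − Σ w‖² is the same for
-- every a ≠ 0; summed over all a ∈ F_q it equals (q − 1) q^{d+1} ‖w‖², because x·y = x·y′ holds
-- for q^{d−1} points x unless y = y′.  Hence its value at a = t is at most q^{d+1} ‖w‖², which for
-- w = u_b is q^{d+1} 𝒫_{2b}.  The two bounds are the cases (a, b) = (k, k) and (k, k − 1).

-- Scoped so that its integer notation (_≤_, _^_ on ℤ) stays apart from the natural-number
-- notation in which the theorem is stated.
module _ where

  open import Defs
  open import Data.Bool using (Bool; true; false; _∧_)
  open import Data.Bool.Properties using () renaming (_≟_ to _≟ᵇ_)
  open import Data.Empty using (⊥-elim)
  open import Data.Integer using (ℤ; +_; -[1+_]; 0ℤ; 1ℤ; _+_; _-_; -_; _*_; _^_; _≤_; +≤+)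
  import Data.Integer.Properties as ℤ
  open import Data.Integer.Tactic.RingSolver using (solve-∀)
  open import Data.List using (List; []; _∷_; map; concatMap; filter; length; _++_)
  open import Data.List.Membership.Propositional using (_∈_; _∉_)
  open import Data.List.Relation.Unary.All using (lookup)
  open import Data.List.Relation.Unary.AllPairs using (_∷_)
  open import Data.List.Relation.Unary.Any using (here; there)
  open import Data.List.Relation.Unary.Unique.Propositional using (Unique)
  open import Data.Nat as ℕ using (ℕ; zero; suc; z≤n; s≤s)
  import Data.Nat.Properties as ℕₚ
  open import Data.Product using (_,_)
  open import Data.Vec using (Vec; []; _∷_; replicate; zipWith) renaming (map to mapᵥ)
  open import Data.Vec.Properties using (≡-dec; map-∘; map-cong; map-id; ∷-injectiveˡ; ∷-injectiveʳ)
  open import Function.Bundles using (_⇔_; mk⇔; _↔_; mk↔ₛ′; Inverse; Equivalence)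
  open import Function.Properties.Equivalence using () renaming (sym to ⇔-sym; trans to ⇔-trans)
  open import Relation.Binary.Definitions using (DecidableEquality)
  open import Relation.Binary.PropositionalEquality
  open import Relation.Nullary using (Dec; yes; no; does; ¬_)
  open import Relation.Nullary.Decidable using (dec-true; dec-false; does-⇔)
  open import Relation.Unary using (Pred; Decidable)
  open ≡-Reasoning

  ∑ : {A : Set} → List A → (A → ℤ) → ℤ
  ∑ []       f = 0ℤ
  ∑ (x ∷ xs) f = f x + ∑ xs f

  syntax ∑ xs (λ x → e) = ∑[ x ← xs ] e

  ⟦_⟧ : Bool → ℤ
  ⟦ true  ⟧ = 1ℤ
  ⟦ false ⟧ = 0ℤ

  𝟙 : {P : Set} → Dec P → ℤ
  𝟙 p = ⟦ does p ⟧

  ⟦∧⟧ : ∀ a b → ⟦ a ∧ b ⟧ ≡ ⟦ a ⟧ * ⟦ b ⟧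
  ⟦∧⟧ true  b = sym (ℤ.*-identityˡ ⟦ b ⟧)
  ⟦∧⟧ false b = refl

  ⟦⟧-idem : ∀ b → ⟦ b ⟧ * ⟦ b ⟧ ≡ ⟦ b ⟧
  ⟦⟧-idem true  = refl
  ⟦⟧-idem false = refl

  ⟦≟true⟧ : ∀ b → 𝟙 (b ≟ᵇ true) ≡ ⟦ b ⟧
  ⟦≟true⟧ true  = refl
  ⟦≟true⟧ false = refl

  module _ {P : Set} where

    𝟙-yes : (p : Dec P) → P → 𝟙 p ≡ 1ℤ
    𝟙-yes p x = cong ⟦_⟧ (dec-true p x)

    𝟙-no : (p : Dec P) → ¬ P → 𝟙 p ≡ 0ℤ
    𝟙-no p ¬x = cong ⟦_⟧ (dec-false p ¬x)

    𝟙-cong : {Q : Set} → P ⇔ Q → (p : Dec P) (q : Dec Q) → 𝟙 p ≡ 𝟙 q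
    𝟙-cong P⇔Q p q = cong ⟦_⟧ (does-⇔ P⇔Q p q)

  square-nonNeg : ∀ i → 0ℤ ≤ i * i
  square-nonNeg (+ n)    = subst (0ℤ ≤_) (ℤ.pos-* n n) (+≤+ z≤n)
  square-nonNeg -[1+ n ] = subst (0ℤ ≤_) (sym (ℤ.+◃n≡+n (suc n ℕ.* suc n))) (+≤+ z≤n)

  pos-^ : ∀ m k → + (m ℕ.^ k) ≡ (+ m) ^ k
  pos-^ m zero    = refl
  pos-^ m (suc k) = trans (ℤ.pos-* m (m ℕ.^ k)) (cong (+ m *_) (pos-^ m k))

  *-cancelˡ-≤-pred : ∀ {m i j} → + 2 ≤ + m → (+ m - 1ℤ) * i ≤ (+ m - 1ℤ) * j → i ≤ j
  *-cancelˡ-≤-pred {suc (suc m)} _ = ℤ.*-cancelˡ-≤-pos _ _ (+ suc m)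
  *-cancelˡ-≤-pred {suc zero} (+≤+ (s≤s ()))
  *-cancelˡ-≤-pred {zero}     (+≤+ ())

  module _ {A : Set} where

    ∑-cong : (xs : List A) {f g : A → ℤ} → (∀ x → f x ≡ g x) → ∑ xs f ≡ ∑ xs g
    ∑-cong []       f≗g = refl
    ∑-cong (x ∷ xs) f≗g = cong₂ _+_ (f≗g x) (∑-cong xs f≗g)

    ∑-zero : (xs : List A) → ∑[ _ ← xs ] 0ℤ ≡ 0ℤ
    ∑-zero []       = refl
    ∑-zero (x ∷ xs) = trans (ℤ.+-identityˡ _) (∑-zero xs)

    ∑-distrib-+ : (xs : List A) (f g : A → ℤ) → ∑[ x ← xs ] (f x + g x) ≡ ∑ xs f + ∑ xs g
    ∑-distrib-+ []       f g = refl
    ∑-distrib-+ (x ∷ xs) f g = begin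
      f x + g x + ∑[ x ← xs ] (f x + g x)  ≡⟨ cong (_+_ (f x + g x)) (∑-distrib-+ xs f g) ⟩
      f x + g x + (∑ xs f + ∑ xs g)       ≡⟨ shuffle (f x) (g x) (∑ xs f) (∑ xs g) ⟩
      f x + ∑ xs f + (g x + ∑ xs g)       ∎
      where
      shuffle : ∀ a b c d → a + b + (c + d) ≡ a + c + (b + d)
      shuffle = solve-∀

    ∑-factorˡ : (xs : List A) (c : ℤ) (f : A → ℤ) → ∑[ x ← xs ] (c * f x) ≡ c * ∑ xs f
    ∑-factorˡ []       c f = sym (ℤ.*-zeroʳ c)
    ∑-factorˡ (x ∷ xs) c f = trans (cong (_+_ (c * f x)) (∑-factorˡ xs c f))
                                   (sym (ℤ.*-distribˡ-+ c (f x) (∑ xs f)))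

    ∑-factorʳ : (xs : List A) (c : ℤ) (f : A → ℤ) → ∑[ x ← xs ] (f x * c) ≡ ∑ xs f * c
    ∑-factorʳ xs c f = begin
      ∑[ x ← xs ] (f x * c)  ≡⟨ ∑-cong xs (λ x → ℤ.*-comm (f x) c) ⟩
      ∑[ x ← xs ] (c * f x)  ≡⟨ ∑-factorˡ xs c f ⟩
      c * ∑ xs f             ≡⟨ ℤ.*-comm c (∑ xs f) ⟩
      ∑ xs f * c             ∎

    ∑-distrib-neg : (xs : List A) (f : A → ℤ) → ∑[ x ← xs ] (- f x) ≡ - ∑ xs f
    ∑-distrib-neg []       f = refl
    ∑-distrib-neg (x ∷ xs) f = trans (cong (_+_ (- f x)) (∑-distrib-neg xs f))
                                     (sym (ℤ.neg-distrib-+ (f x) (∑ xs f)))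

    ∑-distrib-sub : (xs : List A) (f g : A → ℤ) → ∑[ x ← xs ] (f x - g x) ≡ ∑ xs f - ∑ xs g
    ∑-distrib-sub xs f g = trans (∑-distrib-+ xs f (λ x → - g x))
                                 (cong (_+_ (∑ xs f)) (∑-distrib-neg xs g))

    ∑-const : (xs : List A) (c : ℤ) → ∑[ _ ← xs ] c ≡ + length xs * c
    ∑-const []       c = refl
    ∑-const (x ∷ xs) c = begin
      c + ∑[ _ ← xs ] c      ≡⟨ cong (_+_ c) (∑-const xs c) ⟩
      c + + length xs * c    ≡⟨ identity c (+ length xs) ⟩
      (1ℤ + + length xs) * c ≡⟨ cong (_* c) (sym (ℤ.pos-+ 1 (length xs))) ⟩
      + length (x ∷ xs) * c  ∎
      where
      identity : ∀ c l → c + l * c ≡ (1ℤ + l) * c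
      identity = solve-∀

    ∑-++ : (xs ys : List A) (f : A → ℤ) → ∑ (xs ++ ys) f ≡ ∑ xs f + ∑ ys f
    ∑-++ []       ys f = sym (ℤ.+-identityˡ (∑ ys f))
    ∑-++ (x ∷ xs) ys f = trans (cong (_+_ (f x)) (∑-++ xs ys f)) (sym (ℤ.+-assoc (f x) (∑ xs f) (∑ ys f)))

    ∑-mono-≤ : (xs : List A) {f g : A → ℤ} → (∀ x → f x ≤ g x) → ∑ xs f ≤ ∑ xs g
    ∑-mono-≤ []       f≤g = +≤+ z≤n
    ∑-mono-≤ (x ∷ xs) f≤g = ℤ.+-mono-≤ (f≤g x) (∑-mono-≤ xs f≤g)

    ∑-nonNeg : (xs : List A) {f : A → ℤ} → (∀ x → 0ℤ ≤ f x) → 0ℤ ≤ ∑ xs f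
    ∑-nonNeg xs {f} 0≤f = subst (_≤ ∑ xs f) (∑-zero xs) (∑-mono-≤ xs 0≤f)

    ∑-filter : {P : Pred A _} (P? : Decidable P) (xs : List A) (f : A → ℤ) →
               ∑ (filter P? xs) f ≡ ∑[ x ← xs ] (𝟙 (P? x) * f x)
    ∑-filter P? []       f = refl
    ∑-filter P? (x ∷ xs) f with does (P? x)
    ... | true  = cong₂ _+_ (sym (ℤ.*-identityˡ (f x))) (∑-filter P? xs f)
    ... | false = trans (∑-filter P? xs f) (sym (ℤ.+-identityˡ _))

    length-filter≡∑𝟙 : {P : Pred A _} (P? : Decidable P) (xs : List A) →
                       + length (filter P? xs) ≡ ∑[ x ← xs ] 𝟙 (P? x)
    length-filter≡∑𝟙 P? xs = begin
      + length (filter P? xs)       ≡⟨ sym (trans (∑-const (filter P? xs) 1ℤ) (ℤ.*-identityʳ _)) ⟩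
      ∑[ _ ← filter P? xs ] 1ℤ      ≡⟨ ∑-filter P? xs _ ⟩
      ∑[ x ← xs ] (𝟙 (P? x) * 1ℤ)   ≡⟨ ∑-cong xs (λ x → ℤ.*-identityʳ _) ⟩
      ∑[ x ← xs ] 𝟙 (P? x)          ∎

  module _ {A B : Set} where

    ∑-map : (g : A → B) (xs : List A) (f : B → ℤ) → ∑ (map g xs) f ≡ ∑[ x ← xs ] f (g x)
    ∑-map g []       f = refl
    ∑-map g (x ∷ xs) f = cong (_+_ (f (g x))) (∑-map g xs f)

    ∑-concatMap : (g : A → List B) (xs : List A) (f : B → ℤ) →
                  ∑ (concatMap g xs) f ≡ ∑[ x ← xs ] ∑ (g x) f
    ∑-concatMap g []       f = refl
    ∑-concatMap g (x ∷ xs) f = trans (∑-++ (g x) (concatMap g xs) f)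
                                     (cong (_+_ (∑ (g x) f)) (∑-concatMap g xs f))

    ∑-comm : (xs : List A) (ys : List B) (f : A → B → ℤ) →
             ∑[ x ← xs ] ∑[ y ← ys ] f x y ≡ ∑[ y ← ys ] ∑[ x ← xs ] f x y
    ∑-comm []       ys f = sym (∑-zero ys)
    ∑-comm (x ∷ xs) ys f = trans (cong (_+_ (∑[ y ← ys ] f x y)) (∑-comm xs ys f))
                                 (sym (∑-distrib-+ ys (f x) (λ y → ∑[ x ← xs ] f x y)))

    ∑-*-∑ : (xs : List A) (ys : List B) (f : A → ℤ) (g : B → ℤ) →
            ∑ xs f * ∑ ys g ≡ ∑[ x ← xs ] ∑[ y ← ys ] (f x * g y)
    ∑-*-∑ xs ys f g = trans (sym (∑-factorʳ xs (∑ ys g) f))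
                            (∑-cong xs (λ x → sym (∑-factorˡ ys (f x) g)))

  module _ {A : Set} where

    ∑-linear : (xs : List A) (f g h : A → ℤ) (k : ℤ) →
               ∑[ x ← xs ] (f x + g x - k * h x) ≡ ∑ xs f + ∑ xs g - k * ∑ xs h
    ∑-linear xs f g h k = begin
      ∑[ x ← xs ] (f x + g x - k * h x)
        ≡⟨ ∑-distrib-sub xs _ _ ⟩
      ∑[ x ← xs ] (f x + g x) - ∑[ x ← xs ] (k * h x)
        ≡⟨ cong₂ _-_ (∑-distrib-+ xs f g) (∑-factorˡ xs k h) ⟩
      ∑ xs f + ∑ xs g - k * ∑ xs h ∎

    -- Lagrange's identity: ∑ₓ ∑ᵧ (f x g y − f y g x)² = 2 (∑ f² ∑ g² − (∑ f g)²).
    ∑-cauchy-schwarz : (xs : List A) (f g : A → ℤ) →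
                       ∑[ x ← xs ] (f x * g x) * ∑[ x ← xs ] (f x * g x)
                         ≤ ∑[ x ← xs ] (f x * f x) * ∑[ x ← xs ] (g x * g x)
    ∑-cauchy-schwarz xs f g =
      ℤ.0≤i-j⇒j≤i (ℤ.*-cancelˡ-≤-pos 0ℤ (ff * gg - fg * fg) (+ 2)
        (subst (0ℤ ≤_) lagrange (∑-nonNeg xs (λ x → ∑-nonNeg xs (λ y → square-nonNeg (D x y))))))
      where
      ff gg fg : ℤ
      ff = ∑[ x ← xs ] (f x * f x)
      gg = ∑[ x ← xs ] (g x * g x)
      fg = ∑[ x ← xs ] (f x * g x)

      D : A → A → ℤ
      D x y = f x * g y - f y * g x

      expand : ∀ x y → D x y * D x y
                     ≡ (f x * f x) * (g y * g y) + (g x * g x) * (f y * f y) - + 2 * ((f x * g x) * (f y * g y))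
      expand x y = identity (f x) (g x) (f y) (g y)
        where
        identity : ∀ a b c d → (a * d - c * b) * (a * d - c * b)
                               ≡ (a * a) * (d * d) + (b * b) * (c * c) - + 2 * ((a * b) * (c * d))
        identity = solve-∀

      lagrange : ∑[ x ← xs ] ∑[ y ← xs ] (D x y * D x y) ≡ + 2 * (ff * gg - fg * fg)
      lagrange = begin
        ∑[ x ← xs ] ∑[ y ← xs ] (D x y * D x y)
          ≡⟨ ∑-cong xs (λ x → trans (∑-cong xs (expand x)) (∑-linear xs _ _ _ (+ 2))) ⟩
        ∑[ x ← xs ] (∑[ y ← xs ] ((f x * f x) * (g y * g y)) + ∑[ y ← xs ] ((g x * g x) * (f y * f y))
                      - + 2 * ∑[ y ← xs ] ((f x * g x) * (f y * g y)))
          ≡⟨ ∑-linear xs _ _ _ (+ 2) ⟩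
        ∑[ x ← xs ] ∑[ y ← xs ] ((f x * f x) * (g y * g y))
          + ∑[ x ← xs ] ∑[ y ← xs ] ((g x * g x) * (f y * f y))
          - + 2 * ∑[ x ← xs ] ∑[ y ← xs ] ((f x * g x) * (f y * g y))
          ≡⟨ cong₂ _-_ (cong₂ _+_ (sym (∑-*-∑ xs xs _ _)) (sym (∑-*-∑ xs xs _ _)))
                       (cong (+ 2 *_) (sym (∑-*-∑ xs xs _ _))) ⟩
        ff * gg + gg * ff - + 2 * (fg * fg)
          ≡⟨ identity ff gg fg ⟩
        + 2 * (ff * gg - fg * fg) ∎
        where
        identity : ∀ a b c → a * b + b * a - + 2 * (c * c) ≡ + 2 * (a * b - c * c)
        identity = solve-∀

  module _ {A : Set} (_≟_ : DecidableEquality A) where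

    -- Summing against the indicator of b picks out the value at b exactly when b occurs once in the list.
    IsEnumeration : List A → Set
    IsEnumeration xs = ∀ b (f : A → ℤ) → ∑[ a ← xs ] (𝟙 (b ≟ a) * f a) ≡ f b

    ∑-𝟙≟-∉ : ∀ {b} (xs : List A) (f : A → ℤ) → b ∉ xs → ∑[ a ← xs ] (𝟙 (b ≟ a) * f a) ≡ 0ℤ
    ∑-𝟙≟-∉ []           f b∉xs = refl
    ∑-𝟙≟-∉ {b} (x ∷ xs) f b∉xs =
      cong₂ _+_ (cong (_* f x) (𝟙-no (b ≟ x) (λ b≡x → b∉xs (here b≡x))))
                (∑-𝟙≟-∉ xs f (λ b∈xs → b∉xs (there b∈xs)))

    ∑-𝟙≟-∈ : ∀ {b xs} (f : A → ℤ) → Unique xs → b ∈ xs → ∑[ a ← xs ] (𝟙 (b ≟ a) * f a) ≡ f b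
    ∑-𝟙≟-∈ {b} {x ∷ xs} f (x≢xs ∷ _) (here refl) = begin
      𝟙 (b ≟ b) * f b + ∑[ a ← xs ] (𝟙 (b ≟ a) * f a)
        ≡⟨ cong₂ _+_ (cong (_* f b) (𝟙-yes (b ≟ b) refl))
                     (∑-𝟙≟-∉ xs f (λ b∈xs → lookup x≢xs b∈xs refl)) ⟩
      1ℤ * f b + 0ℤ
        ≡⟨ trans (ℤ.+-identityʳ _) (ℤ.*-identityˡ (f b)) ⟩
      f b ∎
    ∑-𝟙≟-∈ {b} {x ∷ xs} f (x≢xs ∷ u) (there b∈xs) = begin
      𝟙 (b ≟ x) * f x + ∑[ a ← xs ] (𝟙 (b ≟ a) * f a)
        ≡⟨ cong₂ _+_ (cong (_* f x) (𝟙-no (b ≟ x) (λ b≡x → lookup x≢xs b∈xs (sym b≡x))))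
                     (∑-𝟙≟-∈ f u b∈xs) ⟩
      0ℤ + f b
        ≡⟨ ℤ.+-identityˡ (f b) ⟩
      f b ∎

    unique∧complete⇒isEnumeration : ∀ {xs} → Unique xs → (∀ b → b ∈ xs) → IsEnumeration xs
    unique∧complete⇒isEnumeration u complete b f = ∑-𝟙≟-∈ f u (complete b)

    module _ (xs : List A) (enum : IsEnumeration xs) where

      ∑-𝟙≟ : ∀ b → ∑[ a ← xs ] 𝟙 (b ≟ a) ≡ 1ℤ
      ∑-𝟙≟ b = trans (∑-cong xs (λ a → sym (ℤ.*-identityʳ (𝟙 (b ≟ a))))) (enum b (λ _ → 1ℤ))

      ∑-reindex : (σ : A ↔ A) (h : A → ℤ) → ∑[ x ← xs ] h (Inverse.to σ x) ≡ ∑ xs h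
      ∑-reindex σ h = begin
        ∑[ x ← xs ] h (to x)                          ≡⟨ ∑-cong xs (λ x → sym (enum (to x) h)) ⟩
        ∑[ x ← xs ] ∑[ y ← xs ] (𝟙 (to x ≟ y) * h y)  ≡⟨ ∑-comm xs xs _ ⟩
        ∑[ y ← xs ] ∑[ x ← xs ] (𝟙 (to x ≟ y) * h y)  ≡⟨ ∑-cong xs (λ y → ∑-factorʳ xs (h y) _) ⟩
        ∑[ y ← xs ] (∑[ x ← xs ] 𝟙 (to x ≟ y) * h y)  ≡⟨ ∑-cong xs (λ y → cong (_* h y) (preimage y)) ⟩
        ∑[ y ← xs ] (1ℤ * h y)                        ≡⟨ ∑-cong xs (λ y → ℤ.*-identityˡ (h y)) ⟩
        ∑ xs h                                        ∎
        where
        open Inverse σ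
        preimage : ∀ y → ∑[ x ← xs ] 𝟙 (to x ≟ y) ≡ 1ℤ
        preimage y = trans (∑-cong xs (λ x → 𝟙-cong to⇔from (to x ≟ y) (from y ≟ x))) (∑-𝟙≟ (from y))
          where
          to⇔from : ∀ {x} → to x ≡ y ⇔ from y ≡ x
          to⇔from = mk⇔ (λ e → inverseʳ (sym e)) (λ e → inverseˡ (sym e))

  module _ (F : FiniteField) {A : Set} (xs : List A) where

    ∑-allVecs-suc : ∀ n (f : Vec A (suc n) → ℤ) →
                    ∑ (allVecs F xs (suc n)) f ≡ ∑[ a ← xs ] ∑[ v ← allVecs F xs n ] f (a ∷ v)
    ∑-allVecs-suc n f = trans (∑-concatMap _ xs f) (∑-cong xs (λ a → ∑-map (a ∷_) (allVecs F xs n) f))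

    ∑-allVecs-const : ∀ n (c : ℤ) → ∑[ _ ← allVecs F xs n ] c ≡ (+ length xs) ^ n * c
    ∑-allVecs-const zero    c = trans (ℤ.+-identityʳ c) (sym (ℤ.*-identityˡ c))
    ∑-allVecs-const (suc n) c = begin
      ∑[ _ ← allVecs F xs (suc n) ] c                ≡⟨ ∑-allVecs-suc n (λ _ → c) ⟩
      ∑[ _ ← xs ] ∑[ _ ← allVecs F xs n ] c          ≡⟨ ∑-cong xs (λ _ → ∑-allVecs-const n c) ⟩
      ∑[ _ ← xs ] ((+ length xs) ^ n * c)            ≡⟨ ∑-const xs _ ⟩
      + length xs * ((+ length xs) ^ n * c)          ≡⟨ sym (ℤ.*-assoc (+ length xs) _ c) ⟩
      (+ length xs) ^ suc n * c                      ∎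

    allVecs-isEnumeration : (_≟_ : DecidableEquality A) → IsEnumeration _≟_ xs →
                            ∀ n → IsEnumeration (≡-dec _≟_) (allVecs F xs n)
    allVecs-isEnumeration _≟_ enum zero    [] f = trans (ℤ.+-identityʳ _) (ℤ.*-identityˡ (f []))
    allVecs-isEnumeration _≟_ enum (suc n) (b ∷ w) f = begin
      ∑[ v ← allVecs F xs (suc n) ] (𝟙 ((b ∷ w) ≟ᵥ v) * f v)
        ≡⟨ ∑-allVecs-suc n _ ⟩
      ∑[ a ← xs ] ∑[ v ← allVecs F xs n ] (𝟙 ((b ∷ w) ≟ᵥ (a ∷ v)) * f (a ∷ v))
        ≡⟨ ∑-cong xs (λ a → ∑-cong (allVecs F xs n) (λ v → split a v)) ⟩
      ∑[ a ← xs ] ∑[ v ← allVecs F xs n ] (𝟙 (b ≟ a) * (𝟙 (w ≟ᵥ v) * f (a ∷ v)))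
        ≡⟨ ∑-cong xs (λ a → ∑-factorˡ (allVecs F xs n) (𝟙 (b ≟ a)) _) ⟩
      ∑[ a ← xs ] (𝟙 (b ≟ a) * ∑[ v ← allVecs F xs n ] (𝟙 (w ≟ᵥ v) * f (a ∷ v)))
        ≡⟨ ∑-cong xs (λ a → cong (𝟙 (b ≟ a) *_)
                                 (allVecs-isEnumeration _≟_ enum n w (λ v → f (a ∷ v)))) ⟩
      ∑[ a ← xs ] (𝟙 (b ≟ a) * f (a ∷ w))
        ≡⟨ enum b (λ a → f (a ∷ w)) ⟩
      f (b ∷ w) ∎
      where
      _≟ᵥ_ : ∀ {m} → DecidableEquality (Vec A m)
      _≟ᵥ_ = ≡-dec _≟_
      split : ∀ a v → 𝟙 ((b ∷ w) ≟ᵥ (a ∷ v)) * f (a ∷ v)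
                      ≡ 𝟙 (b ≟ a) * (𝟙 (w ≟ᵥ v) * f (a ∷ v))
      split a v = trans (cong (_* f (a ∷ v)) (⟦∧⟧ (does (b ≟ a)) (does (w ≟ᵥ v))))
                        (ℤ.*-assoc (𝟙 (b ≟ a)) (𝟙 (w ≟ᵥ v)) (f (a ∷ v)))

  module _ (F : FiniteField) where

    open FiniteField F
      using (Carrier; 0#; 1#; 1≢0; _≟_; inverse; elems; unique; complete; order; ≈⇒≡; reflexive; ring;
             +-abelianGroup; +-commutativeSemigroup; *-commutativeSemigroup; +-assoc; +-identityʳ; -‿inverseʳ;
             *-assoc; *-comm; *-identityˡ; *-identityʳ; zeroˡ; zeroʳ; distribʳ)
      renaming (_+_ to infixl 6 _+ᶠ_; _*_ to infixl 7 _*ᶠ_; _-_ to infixl 6 _-ᶠ_; -_ to infix 8 -ᶠ_)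
    open import Algebra.Properties.AbelianGroup +-abelianGroup
      using (xyx⁻¹≈y; ⁻¹-∙-comm; x∙y⁻¹≈ε⇒x≈y; x≈y⇒x∙y⁻¹≈ε)
    open import Algebra.Properties.CommutativeSemigroup +-commutativeSemigroup using (interchange)
    open import Algebra.Properties.CommutativeSemigroup *-commutativeSemigroup using (xy∙z≈xz∙y)
    open import Algebra.Properties.Ring ring using (x[y-z]≈xy-xz)

    +-moveˡ : ∀ a b c → a +ᶠ b ≡ c ⇔ b ≡ c -ᶠ a
    +-moveˡ a b c = mk⇔ to from
      where
      to : a +ᶠ b ≡ c → b ≡ c -ᶠ a
      to a+b≡c = trans (sym (≈⇒≡ (xyx⁻¹≈y a b))) (cong (_-ᶠ a) a+b≡c)
      from : b ≡ c -ᶠ a → a +ᶠ b ≡ c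
      from refl = trans (sym (≈⇒≡ (+-assoc a c (-ᶠ a)))) (≈⇒≡ (xyx⁻¹≈y a c))

    -≡0⇔≡ : ∀ a b → a -ᶠ b ≡ 0# ⇔ a ≡ b
    -≡0⇔≡ a b = mk⇔ (λ a-b≡0 → ≈⇒≡ (x∙y⁻¹≈ε⇒x≈y a b (reflexive a-b≡0)))
                    (λ { refl → ≈⇒≡ (x≈y⇒x∙y⁻¹≈ε (reflexive refl)) })

    *-inverse-⇔ : ∀ {a a⁻¹ u c} → a *ᶠ a⁻¹ ≡ 1# → u *ᶠ a ≡ c ⇔ u ≡ c *ᶠ a⁻¹
    *-inverse-⇔ {a} {a⁻¹} {u} {c} inv = mk⇔ to from
      where
      to : u *ᶠ a ≡ c → u ≡ c *ᶠ a⁻¹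
      to refl = begin
        u                    ≡⟨ sym (≈⇒≡ (*-identityʳ u)) ⟩
        u *ᶠ 1#              ≡⟨ cong (u *ᶠ_) (sym inv) ⟩
        u *ᶠ (a *ᶠ a⁻¹)      ≡⟨ sym (≈⇒≡ (*-assoc u a a⁻¹)) ⟩
        u *ᶠ a *ᶠ a⁻¹        ∎
      from : u ≡ c *ᶠ a⁻¹ → u *ᶠ a ≡ c
      from refl = begin
        c *ᶠ a⁻¹ *ᶠ a        ≡⟨ ≈⇒≡ (*-assoc c a⁻¹ a) ⟩
        c *ᶠ (a⁻¹ *ᶠ a)      ≡⟨ cong (c *ᶠ_) (trans (≈⇒≡ (*-comm a⁻¹ a)) inv) ⟩
        c *ᶠ 1#              ≡⟨ ≈⇒≡ (*-identityʳ c) ⟩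
        c                    ∎

    *-inverse-≡1⇔ : ∀ {a a⁻¹ u} → a *ᶠ a⁻¹ ≡ 1# → u *ᶠ a⁻¹ ≡ 1# ⇔ u ≡ a
    *-inverse-≡1⇔ {a} {a⁻¹} {u} inv = subst (λ v → u *ᶠ a⁻¹ ≡ 1# ⇔ u ≡ v) (≈⇒≡ (*-identityˡ a))
                                            (*-inverse-⇔ (trans (≈⇒≡ (*-comm a⁻¹ a)) inv))

    dot-zeroʳ : ∀ {n} (x : Point F n) → dot F x (replicate n 0#) ≡ 0#
    dot-zeroʳ []      = refl
    dot-zeroʳ (a ∷ x) = trans (cong₂ _+ᶠ_ (≈⇒≡ (zeroʳ a)) (dot-zeroʳ x)) (≈⇒≡ (+-identityʳ 0#))

    dot-distrib-sub : ∀ {n} (x y y′ : Point F n) → dot F x (zipWith _-ᶠ_ y y′) ≡ dot F x y -ᶠ dot F x y′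
    dot-distrib-sub []      []      []        = sym (≈⇒≡ (-‿inverseʳ 0#))
    dot-distrib-sub (a ∷ x) (b ∷ y) (b′ ∷ y′) = begin
      a *ᶠ (b -ᶠ b′) +ᶠ dot F x (zipWith _-ᶠ_ y y′)
        ≡⟨ cong₂ _+ᶠ_ (≈⇒≡ (x[y-z]≈xy-xz a b b′)) (dot-distrib-sub x y y′) ⟩
      (a *ᶠ b -ᶠ a *ᶠ b′) +ᶠ (dot F x y -ᶠ dot F x y′)
        ≡⟨ ≈⇒≡ (interchange (a *ᶠ b) (-ᶠ (a *ᶠ b′)) (dot F x y) (-ᶠ dot F x y′)) ⟩
      (a *ᶠ b +ᶠ dot F x y) +ᶠ (-ᶠ (a *ᶠ b′) +ᶠ -ᶠ dot F x y′)
        ≡⟨ cong (a *ᶠ b +ᶠ dot F x y +ᶠ_) (≈⇒≡ (⁻¹-∙-comm (a *ᶠ b′) (dot F x y′))) ⟩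
      (a *ᶠ b +ᶠ dot F x y) -ᶠ (a *ᶠ b′ +ᶠ dot F x y′) ∎

    dot-comm : ∀ {n} (x y : Point F n) → dot F x y ≡ dot F y x
    dot-comm []      []      = refl
    dot-comm (a ∷ x) (b ∷ y) = cong₂ _+ᶠ_ (≈⇒≡ (*-comm a b)) (dot-comm x y)

    scaleᵥ : ∀ {n} → Carrier → Point F n → Point F n
    scaleᵥ s = mapᵥ (_*ᶠ s)

    dot-scaleᵥ : ∀ {n} s (x y : Point F n) → dot F (scaleᵥ s x) y ≡ dot F x y *ᶠ s
    dot-scaleᵥ s []      []      = sym (≈⇒≡ (zeroˡ s))
    dot-scaleᵥ s (a ∷ x) (b ∷ y) = begin
      a *ᶠ s *ᶠ b +ᶠ dot F (scaleᵥ s x) y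
        ≡⟨ cong₂ _+ᶠ_ (≈⇒≡ (xy∙z≈xz∙y a s b)) (dot-scaleᵥ s x y) ⟩
      a *ᶠ b *ᶠ s +ᶠ dot F x y *ᶠ s
        ≡⟨ sym (≈⇒≡ (distribʳ s (a *ᶠ b) (dot F x y))) ⟩
      (a *ᶠ b +ᶠ dot F x y) *ᶠ s ∎

    scaleᵥ-cancel : ∀ {n s s⁻¹} → s *ᶠ s⁻¹ ≡ 1# → (x : Point F n) → scaleᵥ s⁻¹ (scaleᵥ s x) ≡ x
    scaleᵥ-cancel {s = s} {s⁻¹} inv x = begin
      scaleᵥ s⁻¹ (scaleᵥ s x)        ≡⟨ sym (map-∘ (_*ᶠ s⁻¹) (_*ᶠ s) x) ⟩
      mapᵥ (λ c → c *ᶠ s *ᶠ s⁻¹) x   ≡⟨ map-cong (λ c → sym (Equivalence.to (*-inverse-⇔ inv) refl)) x ⟩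
      mapᵥ (λ c → c) x               ≡⟨ map-id x ⟩
      x                              ∎

    scaling : ∀ {n a a⁻¹} → a *ᶠ a⁻¹ ≡ 1# → Point F n ↔ Point F n
    scaling {a = a} {a⁻¹} inv = mk↔ₛ′ (scaleᵥ a⁻¹) (scaleᵥ a)
      (scaleᵥ-cancel inv) (scaleᵥ-cancel (trans (≈⇒≡ (*-comm a⁻¹ a)) inv))

    zipWith-sub≡0⇔≡ : ∀ {n} (y y′ : Point F n) → zipWith _-ᶠ_ y y′ ≡ replicate n 0# ⇔ y ≡ y′
    zipWith-sub≡0⇔≡ []      []        = mk⇔ (λ _ → refl) (λ _ → refl)
    zipWith-sub≡0⇔≡ (b ∷ y) (b′ ∷ y′) = mk⇔
      (λ eq → cong₂ _∷_ (Equivalence.to (-≡0⇔≡ b b′) (∷-injectiveˡ eq))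
                        (Equivalence.to (zipWith-sub≡0⇔≡ y y′) (∷-injectiveʳ eq)))
      (λ eq → cong₂ _∷_ (Equivalence.from (-≡0⇔≡ b b′) (∷-injectiveˡ eq))
                        (Equivalence.from (zipWith-sub≡0⇔≡ y y′) (∷-injectiveʳ eq)))

    q : ℤ
    q = + order

    allPoints : ∀ n → List (Point F n)
    allPoints = allVecs F elems

    _≟ᵥ_ : ∀ {n} → DecidableEquality (Point F n)
    _≟ᵥ_ = ≡-dec _≟_

    elems-isEnumeration : IsEnumeration _≟_ elems
    elems-isEnumeration = unique∧complete⇒isEnumeration _≟_ unique complete

    allPoints-isEnumeration : ∀ n → IsEnumeration _≟ᵥ_ (allPoints n)
    allPoints-isEnumeration = allVecs-isEnumeration F elems _≟_ elems-isEnumeration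

    ∑-elems-𝟙≟ : ∀ b → ∑[ a ← elems ] 𝟙 (b ≟ a) ≡ 1ℤ
    ∑-elems-𝟙≟ = ∑-𝟙≟ _≟_ elems elems-isEnumeration

    2≤q : + 2 ≤ q
    2≤q = subst₂ _≤_ two (trans (∑-const elems 1ℤ) (ℤ.*-identityʳ q))
                     (∑-mono-≤ elems (λ a → atMostOne (0# ≟ a) (1# ≟ a)))
      where
      atMostOne : ∀ {a} (0≟a : Dec (0# ≡ a)) (1≟a : Dec (1# ≡ a)) → 𝟙 0≟a + 𝟙 1≟a ≤ 1ℤ
      atMostOne (yes refl) (yes 1≡0) = ⊥-elim (1≢0 1≡0)
      atMostOne (yes _)    (no _)    = ℤ.≤-refl
      atMostOne (no _)     (yes _)   = ℤ.≤-refl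
      atMostOne (no _)     (no _)    = +≤+ z≤n
      two : ∑[ a ← elems ] (𝟙 (0# ≟ a) + 𝟙 (1# ≟ a)) ≡ + 2
      two = trans (∑-distrib-+ elems _ _)
                  (cong₂ _+_ (∑-elems-𝟙≟ 0#) (∑-elems-𝟙≟ 1#))

    solutions : ∀ {n} → Point F n → Carrier → ℤ
    solutions {n} z c = ∑[ x ← allPoints n ] 𝟙 (dot F x z ≟ c)

    solutions-zero : ∀ n c → solutions (replicate n 0#) c ≡ q ^ n * 𝟙 (0# ≟ c)
    solutions-zero n c = begin
      ∑[ x ← allPoints n ] 𝟙 (dot F x (replicate n 0#) ≟ c)
        ≡⟨ ∑-cong (allPoints n) (λ x → 𝟙-cong (mk⇔ (trans (sym (dot-zeroʳ x))) (trans (dot-zeroʳ x)))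
                                                    (dot F x (replicate n 0#) ≟ c) (0# ≟ c)) ⟩
      ∑[ x ← allPoints n ] 𝟙 (0# ≟ c)
        ≡⟨ ∑-allVecs-const F elems n _ ⟩
      q ^ n * 𝟙 (0# ≟ c) ∎

    solutions-∷ : ∀ {n} b (z : Point F n) c →
                  solutions (b ∷ z) c ≡ ∑[ a ← elems ] solutions z (c -ᶠ a *ᶠ b)
    solutions-∷ b z c = trans (∑-allVecs-suc F elems _ _)
      (∑-cong elems (λ a → ∑-cong (allPoints _) (λ u →
        𝟙-cong (+-moveˡ (a *ᶠ b) (dot F u z) c) ((a *ᶠ b +ᶠ dot F u z) ≟ c) (dot F u z ≟ (c -ᶠ a *ᶠ b)))))

    solutions-nonzero : ∀ {n} (z : Point F (suc n)) c → ¬ z ≡ replicate (suc n) 0# → solutions z c ≡ q ^ n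
    solutions-nonzero {n} (b ∷ z) c z≢0 with z ≟ᵥ replicate n 0#
    ... | yes refl with inverse b (λ b≡0 → z≢0 (cong (_∷ replicate n 0#) b≡0))
    ...   | b⁻¹ , inv = begin
      solutions (b ∷ replicate n 0#) c
        ≡⟨ solutions-∷ b _ c ⟩
      ∑[ a ← elems ] solutions (replicate n 0#) (c -ᶠ a *ᶠ b)
        ≡⟨ ∑-cong elems (λ a → solutions-zero n _) ⟩
      ∑[ a ← elems ] (q ^ n * 𝟙 (0# ≟ (c -ᶠ a *ᶠ b)))
        ≡⟨ ∑-cong elems (λ a → cong (q ^ n *_)
                                    (𝟙-cong (root a) (0# ≟ (c -ᶠ a *ᶠ b)) ((c *ᶠ b⁻¹) ≟ a))) ⟩
      ∑[ a ← elems ] (q ^ n * 𝟙 ((c *ᶠ b⁻¹) ≟ a))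
        ≡⟨ ∑-factorˡ elems (q ^ n) _ ⟩
      q ^ n * ∑[ a ← elems ] 𝟙 ((c *ᶠ b⁻¹) ≟ a)
        ≡⟨ cong (q ^ n *_) (∑-elems-𝟙≟ _) ⟩
      q ^ n * 1ℤ
        ≡⟨ ℤ.*-identityʳ (q ^ n) ⟩
      q ^ n ∎
      where
      ≡-comm : ∀ {x y : Carrier} → x ≡ y ⇔ y ≡ x
      ≡-comm = mk⇔ sym sym
      root : ∀ a → 0# ≡ c -ᶠ a *ᶠ b ⇔ c *ᶠ b⁻¹ ≡ a
      root a = ⇔-trans ≡-comm (⇔-trans (-≡0⇔≡ c (a *ᶠ b))
                 (⇔-trans ≡-comm (⇔-trans (*-inverse-⇔ inv) ≡-comm)))
    solutions-nonzero {zero}  (b ∷ []) c z≢0 | no []≢[] = ⊥-elim ([]≢[] refl)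
    solutions-nonzero {suc n} (b ∷ z)  c _   | no z≢0 = begin
      solutions (b ∷ z) c                           ≡⟨ solutions-∷ b z c ⟩
      ∑[ a ← elems ] solutions z (c -ᶠ a *ᶠ b)      ≡⟨ ∑-cong elems (λ a → solutions-nonzero z _ z≢0) ⟩
      ∑[ _ ← elems ] (q ^ n)                        ≡⟨ ∑-const elems _ ⟩
      q ^ suc n                                     ∎

    agreements : ∀ {n} (y y′ : Point F (suc n)) →
                 ∑[ x ← allPoints (suc n) ] 𝟙 (dot F x y′ ≟ dot F x y)
                   ≡ q ^ n + 𝟙 (y′ ≟ᵥ y) * (q ^ suc n - q ^ n)
    agreements {n} y y′ = trans (∑-cong (allPoints (suc n)) (λ x →
      𝟙-cong (difference x) (dot F x y′ ≟ dot F x y) (dot F x (zipWith _-ᶠ_ y′ y) ≟ 0#))) (count (y′ ≟ᵥ y))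
      where
      difference : ∀ x → dot F x y′ ≡ dot F x y ⇔ dot F x (zipWith _-ᶠ_ y′ y) ≡ 0#
      difference x = mk⇔ (λ e → trans (dot-distrib-sub x y′ y) (Equivalence.from (-≡0⇔≡ _ _) e))
                         (λ e → Equivalence.to (-≡0⇔≡ _ _) (trans (sym (dot-distrib-sub x y′ y)) e))
      count : (y′≟y : Dec (y′ ≡ y)) →
              solutions (zipWith _-ᶠ_ y′ y) 0# ≡ q ^ n + 𝟙 y′≟y * (q ^ suc n - q ^ n)
      count (yes refl) = begin
        solutions (zipWith _-ᶠ_ y y) 0#
          ≡⟨ cong (λ z → solutions z 0#) (Equivalence.from (zipWith-sub≡0⇔≡ y y) refl) ⟩
        solutions (replicate (suc n) 0#) 0#
          ≡⟨ solutions-zero (suc n) 0# ⟩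
        q ^ suc n * 𝟙 (0# ≟ 0#)
          ≡⟨ cong (q ^ suc n *_) (𝟙-yes (0# ≟ 0#) refl) ⟩
        q ^ suc n * 1ℤ
          ≡⟨ identity (q ^ suc n) (q ^ n) ⟩
        q ^ n + 1ℤ * (q ^ suc n - q ^ n) ∎
        where
        identity : ∀ a b → a * 1ℤ ≡ b + 1ℤ * (a - b)
        identity = solve-∀
      count (no y′≢y) = trans (solutions-nonzero _ 0# (λ e → y′≢y (Equivalence.to (zipWith-sub≡0⇔≡ y′ y) e)))
                              (sym (ℤ.+-identityʳ (q ^ n)))

    module _ {n : ℕ} (w : Point F (suc n) → ℤ) where

      mass : ℤ
      mass = ∑ (allPoints (suc n)) w

      incidence : Carrier → Point F (suc n) → ℤ
      incidence a x = ∑[ y ← allPoints (suc n) ] (𝟙 (dot F x y ≟ a) * w y)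

      discrepancy : Carrier → Point F (suc n) → ℤ
      discrepancy a x = q * incidence a x - mass

      energy : Carrier → ℤ
      energy a = ∑[ x ← allPoints (suc n) ] (discrepancy a x * discrepancy a x)

      energy≡energy-1 : ∀ {a} → ¬ a ≡ 0# → energy a ≡ energy 1#
      energy≡energy-1 {a} a≢0 with inverse a a≢0
      ... | a⁻¹ , inv = trans (∑-cong (allPoints (suc n)) (λ x → cong (λ d → d * d) (rescale x)))
                              (∑-reindex _≟ᵥ_ (allPoints (suc n)) (allPoints-isEnumeration (suc n)) (scaling inv)
                                         (λ x → discrepancy 1# x * discrepancy 1# x))
        where
        onLevel : ∀ x y → dot F x y ≡ a ⇔ dot F (scaleᵥ a⁻¹ x) y ≡ 1#
        onLevel x y = subst (λ v → dot F x y ≡ a ⇔ v ≡ 1#) (sym (dot-scaleᵥ a⁻¹ x y))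
                            (⇔-sym (*-inverse-≡1⇔ inv))
        rescale : ∀ x → discrepancy a x ≡ discrepancy 1# (scaleᵥ a⁻¹ x)
        rescale x = cong (λ m → q * m - mass) (∑-cong (allPoints (suc n)) (λ y →
          cong (_* w y) (𝟙-cong (onLevel x y) (dot F x y ≟ a) (dot F (scaleᵥ a⁻¹ x) y ≟ 1#))))

      ∑-incidence : ∀ x → ∑[ a ← elems ] incidence a x ≡ mass
      ∑-incidence x = begin
        ∑[ a ← elems ] ∑[ y ← Pts ] (𝟙 (dot F x y ≟ a) * w y)  ≡⟨ ∑-comm elems Pts _ ⟩
        ∑[ y ← Pts ] ∑[ a ← elems ] (𝟙 (dot F x y ≟ a) * w y)  ≡⟨ ∑-cong Pts fibre ⟩
        mass                                                  ∎
        where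
        Pts = allPoints (suc n)
        fibre : ∀ y → ∑[ a ← elems ] (𝟙 (dot F x y ≟ a) * w y) ≡ w y
        fibre y = trans (∑-factorʳ elems (w y) _)
                        (trans (cong (_* w y) (∑-elems-𝟙≟ (dot F x y))) (ℤ.*-identityˡ (w y)))

      coincidences : Point F (suc n) → ℤ
      coincidences x =
        ∑[ y ← allPoints (suc n) ] ∑[ y′ ← allPoints (suc n) ] (𝟙 (dot F x y ≟ dot F x y′) * (w y * w y′))

      ∑-incidence² : ∀ x → ∑[ a ← elems ] (incidence a x * incidence a x) ≡ coincidences x
      ∑-incidence² x = begin
        ∑[ a ← elems ] (incidence a x * incidence a x)
          ≡⟨ ∑-cong elems (λ a → ∑-*-∑ Pts Pts _ _) ⟩
        ∑[ a ← elems ] ∑[ y ← Pts ] ∑[ y′ ← Pts ] term a y y′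
          ≡⟨ ∑-comm elems Pts _ ⟩
        ∑[ y ← Pts ] ∑[ a ← elems ] ∑[ y′ ← Pts ] term a y y′
          ≡⟨ ∑-cong Pts (λ y → ∑-comm elems Pts _) ⟩
        ∑[ y ← Pts ] ∑[ y′ ← Pts ] ∑[ a ← elems ] term a y y′
          ≡⟨ ∑-cong Pts (λ y → ∑-cong Pts (pick y)) ⟩
        coincidences x ∎
        where
        Pts = allPoints (suc n)
        term : Carrier → Point F (suc n) → Point F (suc n) → ℤ
        term a y y′ = (𝟙 (dot F x y ≟ a) * w y) * (𝟙 (dot F x y′ ≟ a) * w y′)
        pick : ∀ y y′ → ∑[ a ← elems ] term a y y′ ≡ 𝟙 (dot F x y ≟ dot F x y′) * (w y * w y′)
        pick y y′ = trans (∑-cong elems (λ a → shuffle (𝟙 (dot F x y ≟ a)) (w y) (𝟙 (dot F x y′ ≟ a)) (w y′)))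
                          (elems-isEnumeration (dot F x y′) (λ a → 𝟙 (dot F x y ≟ a) * (w y * w y′)))
          where
          shuffle : ∀ e u e′ u′ → (e * u) * (e′ * u′) ≡ e′ * (e * (u * u′))
          shuffle = solve-∀

      ∑-coincidences : ∑ (allPoints (suc n)) coincidences
                       ≡ q ^ n * mass * mass + (q ^ suc n - q ^ n) * ∑[ y ← allPoints (suc n) ] (w y * w y)
      ∑-coincidences = begin
        ∑[ x ← Pts ] ∑[ y ← Pts ] ∑[ y′ ← Pts ] (𝟙 (dot F x y ≟ dot F x y′) * (w y * w y′))
          ≡⟨ ∑-comm Pts Pts _ ⟩
        ∑[ y ← Pts ] ∑[ x ← Pts ] ∑[ y′ ← Pts ] (𝟙 (dot F x y ≟ dot F x y′) * (w y * w y′))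
          ≡⟨ ∑-cong Pts (λ y → ∑-comm Pts Pts _) ⟩
        ∑[ y ← Pts ] ∑[ y′ ← Pts ] ∑[ x ← Pts ] (𝟙 (dot F x y ≟ dot F x y′) * (w y * w y′))
          ≡⟨ ∑-cong Pts (λ y → ∑-cong Pts (λ y′ →
               trans (∑-factorʳ Pts _ _) (cong (_* (w y * w y′)) (agreements y′ y)))) ⟩
        ∑[ y ← Pts ] ∑[ y′ ← Pts ] ((q ^ n + 𝟙 (y ≟ᵥ y′) * D) * (w y * w y′))
          ≡⟨ ∑-cong Pts row ⟩
        ∑[ y ← Pts ] (q ^ n * mass * w y + D * (w y * w y))
          ≡⟨ ∑-distrib-+ Pts _ _ ⟩
        ∑[ y ← Pts ] (q ^ n * mass * w y) + ∑[ y ← Pts ] (D * (w y * w y))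
          ≡⟨ cong₂ _+_ (∑-factorˡ Pts (q ^ n * mass) w) (∑-factorˡ Pts D _) ⟩
        q ^ n * mass * mass + D * ∑[ y ← Pts ] (w y * w y) ∎
        where
        Pts = allPoints (suc n)
        D = q ^ suc n - q ^ n
        row : ∀ y → ∑[ y′ ← Pts ] ((q ^ n + 𝟙 (y ≟ᵥ y′) * D) * (w y * w y′))
                    ≡ q ^ n * mass * w y + D * (w y * w y)
        row y = begin
          ∑[ y′ ← Pts ] ((q ^ n + 𝟙 (y ≟ᵥ y′) * D) * (w y * w y′))
            ≡⟨ ∑-cong Pts (λ y′ → expand (q ^ n) (𝟙 (y ≟ᵥ y′)) D (w y) (w y′)) ⟩
          ∑[ y′ ← Pts ] (q ^ n * w y * w y′ + 𝟙 (y ≟ᵥ y′) * (D * (w y * w y′)))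
            ≡⟨ ∑-distrib-+ Pts _ _ ⟩
          ∑[ y′ ← Pts ] (q ^ n * w y * w y′) + ∑[ y′ ← Pts ] (𝟙 (y ≟ᵥ y′) * (D * (w y * w y′)))
            ≡⟨ cong₂ _+_ (∑-factorˡ Pts (q ^ n * w y) w)
                         (allPoints-isEnumeration (suc n) y (λ y′ → D * (w y * w y′))) ⟩
          q ^ n * w y * mass + D * (w y * w y)
            ≡⟨ cong (_+ D * (w y * w y)) (commute (q ^ n) (w y) mass) ⟩
          q ^ n * mass * w y + D * (w y * w y) ∎
          where
          expand : ∀ P e D u u′ → (P + e * D) * (u * u′) ≡ P * u * u′ + e * (D * (u * u′))
          expand = solve-∀
          commute : ∀ P u m → P * u * m ≡ P * m * u
          commute = solve-∀

      ∑-discrepancy² : ∀ x → ∑[ a ← elems ] (discrepancy a x * discrepancy a x)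
                               ≡ q * q * coincidences x - q * (mass * mass)
      ∑-discrepancy² x = begin
        ∑[ a ← elems ] (discrepancy a x * discrepancy a x)
          ≡⟨ ∑-cong elems (λ a → expand q (incidence a x) mass) ⟩
        ∑[ a ← elems ] (q * q * (incidence a x * incidence a x) + mass * mass - + 2 * q * mass * incidence a x)
          ≡⟨ ∑-linear elems _ _ _ (+ 2 * q * mass) ⟩
        ∑[ a ← elems ] (q * q * (incidence a x * incidence a x)) + ∑[ _ ← elems ] (mass * mass)
          - + 2 * q * mass * ∑[ a ← elems ] incidence a x
          ≡⟨ cong₂ _-_ (cong₂ _+_ (trans (∑-factorˡ elems (q * q) _) (cong (q * q *_) (∑-incidence² x)))
                                  (∑-const elems (mass * mass)))
                       (cong (+ 2 * q * mass *_) (∑-incidence x)) ⟩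
        q * q * coincidences x + q * (mass * mass) - + 2 * q * mass * mass
          ≡⟨ collect q (coincidences x) mass ⟩
        q * q * coincidences x - q * (mass * mass) ∎
        where
        expand : ∀ q m s → (q * m - s) * (q * m - s) ≡ q * q * (m * m) + s * s - + 2 * q * s * m
        expand = solve-∀
        collect : ∀ q c s → q * q * c + q * (s * s) - + 2 * q * s * s ≡ q * q * c - q * (s * s)
        collect = solve-∀

      ∑-energy : ∑ elems energy ≡ (q - 1ℤ) * (q ^ suc (suc n) * ∑[ y ← allPoints (suc n) ] (w y * w y))
      ∑-energy = begin
        ∑[ a ← elems ] ∑[ x ← Pts ] (discrepancy a x * discrepancy a x)
          ≡⟨ ∑-comm elems Pts _ ⟩
        ∑[ x ← Pts ] ∑[ a ← elems ] (discrepancy a x * discrepancy a x)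
          ≡⟨ ∑-cong Pts ∑-discrepancy² ⟩
        ∑[ x ← Pts ] (q * q * coincidences x - q * (mass * mass))
          ≡⟨ ∑-distrib-sub Pts _ _ ⟩
        ∑[ x ← Pts ] (q * q * coincidences x) - ∑[ _ ← Pts ] (q * (mass * mass))
          ≡⟨ cong₂ _-_ (trans (∑-factorˡ Pts (q * q) coincidences) (cong (q * q *_) ∑-coincidences))
                       (∑-allVecs-const F elems (suc n) _) ⟩
        q * q * (q ^ n * mass * mass + (q ^ suc n - q ^ n) * W) - q ^ suc n * (q * (mass * mass))
          ≡⟨ collect q (q ^ n) mass W ⟩
        (q - 1ℤ) * (q ^ suc (suc n) * W) ∎
        where
        Pts = allPoints (suc n)
        W = ∑[ y ← Pts ] (w y * w y)
        collect : ∀ q P s W → q * q * (P * s * s + (q * P - P) * W) - q * P * (q * (s * s))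
                              ≡ (q - 1ℤ) * (q * (q * P) * W)
        collect = solve-∀

      energy-bound : ∀ {t} → ¬ t ≡ 0# → energy t ≤ q ^ suc (suc n) * ∑[ y ← allPoints (suc n) ] (w y * w y)
      energy-bound {t} t≢0 = *-cancelˡ-≤-pred 2≤q
        (subst₂ _≤_ weighted ∑-energy (∑-mono-≤ elems (λ a → dominated (0# ≟ a))))
        where
        dominated : ∀ {a} (0≟a : Dec (0# ≡ a)) → (1ℤ - 𝟙 0≟a) * energy t ≤ energy a
        dominated (yes refl) = ∑-nonNeg (allPoints (suc n)) (λ x → square-nonNeg (discrepancy 0# x))
        dominated (no 0≢a)   = ℤ.≤-reflexive (trans (ℤ.*-identityˡ (energy t))
          (trans (energy≡energy-1 t≢0) (sym (energy≡energy-1 (λ a≡0 → 0≢a (sym a≡0))))))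
        weighted : ∑[ a ← elems ] ((1ℤ - 𝟙 (0# ≟ a)) * energy t) ≡ (q - 1ℤ) * energy t
        weighted = trans (∑-factorʳ elems (energy t) _) (cong (_* energy t)
          (trans (∑-distrib-sub elems _ _)
                 (cong₂ _-_ (trans (∑-const elems 1ℤ) (ℤ.*-identityʳ q)) (∑-elems-𝟙≟ 0#))))

    ∑-incidence-symmetric : ∀ {n} (f g : Point F (suc n) → ℤ) a →
                            ∑[ x ← allPoints (suc n) ] (f x * incidence g a x)
                              ≡ ∑[ y ← allPoints (suc n) ] (incidence f a y * g y)
    ∑-incidence-symmetric {n} f g a = begin
      ∑[ x ← Pts ] (f x * ∑[ y ← Pts ] (𝟙 (dot F x y ≟ a) * g y))
        ≡⟨ ∑-cong Pts (λ x → sym (∑-factorˡ Pts (f x) _)) ⟩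
      ∑[ x ← Pts ] ∑[ y ← Pts ] (f x * (𝟙 (dot F x y ≟ a) * g y))
        ≡⟨ ∑-comm Pts Pts _ ⟩
      ∑[ y ← Pts ] ∑[ x ← Pts ] (f x * (𝟙 (dot F x y ≟ a) * g y))
        ≡⟨ ∑-cong Pts (λ y → ∑-cong Pts (λ x → flip x y)) ⟩
      ∑[ y ← Pts ] ∑[ x ← Pts ] (𝟙 (dot F y x ≟ a) * f x * g y)
        ≡⟨ ∑-cong Pts (λ y → ∑-factorʳ Pts (g y) _) ⟩
      ∑[ y ← Pts ] (∑[ x ← Pts ] (𝟙 (dot F y x ≟ a) * f x) * g y) ∎
      where
      Pts = allPoints (suc n)
      flip : ∀ x y → f x * (𝟙 (dot F x y ≟ a) * g y) ≡ 𝟙 (dot F y x ≟ a) * f x * g y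
      flip x y = trans (cong (λ e → f x * (e * g y)) (cong ⟦_⟧ (cong (λ z → does (z ≟ a)) (dot-comm x y))))
                       (reorder (f x) (𝟙 (dot F y x ≟ a)) (g y))
        where
        reorder : ∀ u e v → u * (e * v) ≡ e * u * v
        reorder = solve-∀

    module _ {n : ℕ} (E : Point F (suc n) → Bool) (t : Carrier) where

      pathsFrom : ℕ → Point F (suc n) → ℤ
      pathsFrom k x = ⟦ E x ⟧ * ∑[ ys ← allVecs F (points F (suc n) E) k ] ⟦ isPath F t (x ∷ ys) ⟧

      ∑-points : (f : Point F (suc n) → ℤ) →
                 ∑ (points F (suc n) E) f ≡ ∑[ x ← allPoints (suc n) ] (⟦ E x ⟧ * f x)
      ∑-points f = trans (∑-filter (λ x → E x ≟ᵇ true) (allPoints (suc n)) f)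
                         (∑-cong (allPoints (suc n)) (λ x → cong (_* f x) (⟦≟true⟧ (E x))))

      𝒫≡∑pathsFrom : ∀ k → + 𝒫 F (suc n) E t k ≡ ∑ (allPoints (suc n)) (pathsFrom k)
      𝒫≡∑pathsFrom k = begin
        + length (filter (λ xs → isPath F t xs ≟ᵇ true) (allVecs F L (suc k)))
          ≡⟨ length-filter≡∑𝟙 (λ xs → isPath F t xs ≟ᵇ true) (allVecs F L (suc k)) ⟩
        ∑[ xs ← allVecs F L (suc k) ] 𝟙 (isPath F t xs ≟ᵇ true)
          ≡⟨ ∑-cong (allVecs F L (suc k)) (λ xs → ⟦≟true⟧ (isPath F t xs)) ⟩
        ∑[ xs ← allVecs F L (suc k) ] ⟦ isPath F t xs ⟧
          ≡⟨ ∑-allVecs-suc F L k _ ⟩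
        ∑[ x ← L ] ∑[ ys ← allVecs F L k ] ⟦ isPath F t (x ∷ ys) ⟧
          ≡⟨ ∑-points _ ⟩
        ∑ (allPoints (suc n)) (pathsFrom k) ∎
        where
        L = points F (suc n) E

      pathsFrom-suc : ∀ k x → pathsFrom (suc k) x ≡ ⟦ E x ⟧ * incidence (pathsFrom k) t x
      pathsFrom-suc k x = cong (⟦ E x ⟧ *_) (begin
        ∑[ ys ← allVecs F L (suc k) ] ⟦ isPath F t (x ∷ ys) ⟧
          ≡⟨ ∑-allVecs-suc F L k _ ⟩
        ∑[ y ← L ] ∑[ ys ← allVecs F L k ] ⟦ does (dot F x y ≟ t) ∧ isPath F t (y ∷ ys) ⟧
          ≡⟨ ∑-cong L (λ y → trans (∑-cong (allVecs F L k) (λ ys → ⟦∧⟧ (does (dot F x y ≟ t)) _))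
                                   (∑-factorˡ (allVecs F L k) (𝟙 (dot F x y ≟ t)) _)) ⟩
        ∑[ y ← L ] (𝟙 (dot F x y ≟ t) * G y)
          ≡⟨ ∑-points _ ⟩
        ∑[ y ← allPoints (suc n) ] (⟦ E y ⟧ * (𝟙 (dot F x y ≟ t) * G y))
          ≡⟨ ∑-cong (allPoints (suc n)) (λ y → swap ⟦ E y ⟧ (𝟙 (dot F x y ≟ t)) (G y)) ⟩
        incidence (pathsFrom k) t x ∎)
        where
        L = points F (suc n) E
        G : Point F (suc n) → ℤ
        G y = ∑[ ys ← allVecs F L k ] ⟦ isPath F t (y ∷ ys) ⟧
        swap : ∀ a b c → a * (b * c) ≡ b * (a * c)
        swap = solve-∀

      pathsFrom-supported : ∀ k x → ⟦ E x ⟧ * pathsFrom k x ≡ pathsFrom k x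
      pathsFrom-supported k x = trans (sym (ℤ.*-assoc ⟦ E x ⟧ ⟦ E x ⟧ G)) (cong (_* G) (⟦⟧-idem (E x)))
        where G = ∑[ ys ← allVecs F (points F (suc n) E) k ] ⟦ isPath F t (x ∷ ys) ⟧

      pathsFrom-0 : ∀ x → pathsFrom 0 x ≡ ⟦ E x ⟧
      pathsFrom-0 x = ℤ.*-identityʳ ⟦ E x ⟧

      pathsFrom-*-incidence : ∀ a b x → pathsFrom a x * incidence (pathsFrom b) t x
                                        ≡ pathsFrom a x * pathsFrom (suc b) x
      pathsFrom-*-incidence a b x = begin
        pathsFrom a x * I                              ≡⟨ cong (_* I) (sym (pathsFrom-supported a x)) ⟩
        ⟦ E x ⟧ * pathsFrom a x * I                    ≡⟨ cong (_* I) (ℤ.*-comm ⟦ E x ⟧ (pathsFrom a x)) ⟩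
        pathsFrom a x * ⟦ E x ⟧ * I                    ≡⟨ ℤ.*-assoc (pathsFrom a x) ⟦ E x ⟧ I ⟩
        pathsFrom a x * (⟦ E x ⟧ * I)                  ≡⟨ cong (pathsFrom a x *_) (sym (pathsFrom-suc b x)) ⟩
        pathsFrom a x * pathsFrom (suc b) x            ∎
        where I = incidence (pathsFrom b) t x

      ∑-pathsFrom-suc : ∀ a b → ∑[ x ← allPoints (suc n) ] (pathsFrom (suc a) x * pathsFrom b x)
                                ≡ ∑[ x ← allPoints (suc n) ] (pathsFrom a x * pathsFrom (suc b) x)
      ∑-pathsFrom-suc a b = begin
        ∑[ x ← Pts ] (pathsFrom (suc a) x * pathsFrom b x)
          ≡⟨ ∑-cong Pts (λ x → trans (ℤ.*-comm (pathsFrom (suc a) x) _) (sym (pathsFrom-*-incidence b a x))) ⟩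
        ∑[ x ← Pts ] (pathsFrom b x * incidence (pathsFrom a) t x)
          ≡⟨ ∑-incidence-symmetric (pathsFrom b) (pathsFrom a) t ⟩
        ∑[ x ← Pts ] (incidence (pathsFrom b) t x * pathsFrom a x)
          ≡⟨ ∑-cong Pts (λ x → trans (ℤ.*-comm _ (pathsFrom a x)) (pathsFrom-*-incidence a b x)) ⟩
        ∑[ x ← Pts ] (pathsFrom a x * pathsFrom (suc b) x) ∎
        where
        Pts = allPoints (suc n)

      ∑-pathsFrom-* : ∀ a b → ∑[ x ← allPoints (suc n) ] (pathsFrom a x * pathsFrom b x)
                              ≡ + 𝒫 F (suc n) E t (a ℕ.+ b)
      ∑-pathsFrom-* zero    b = begin
        ∑[ x ← allPoints (suc n) ] (pathsFrom 0 x * pathsFrom b x)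
          ≡⟨ ∑-cong (allPoints (suc n)) (λ x →
               trans (cong (_* pathsFrom b x) (pathsFrom-0 x)) (pathsFrom-supported b x)) ⟩
        ∑ (allPoints (suc n)) (pathsFrom b)
          ≡⟨ sym (𝒫≡∑pathsFrom b) ⟩
        + 𝒫 F (suc n) E t b ∎
      ∑-pathsFrom-* (suc a) b = begin
        ∑[ x ← allPoints (suc n) ] (pathsFrom (suc a) x * pathsFrom b x)
          ≡⟨ ∑-pathsFrom-suc a b ⟩
        ∑[ x ← allPoints (suc n) ] (pathsFrom a x * pathsFrom (suc b) x)
          ≡⟨ ∑-pathsFrom-* a (suc b) ⟩
        + 𝒫 F (suc n) E t (a ℕ.+ suc b)
          ≡⟨ cong (λ i → + 𝒫 F (suc n) E t i) (ℕₚ.+-suc a b) ⟩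
        + 𝒫 F (suc n) E t (suc a ℕ.+ b) ∎

      𝒫-bound : ¬ t ≡ 0# → ∀ a b {m l l′} → suc (a ℕ.+ b) ≡ m → a ℕ.+ a ≡ l → b ℕ.+ b ≡ l′ →
                let c = q * + 𝒫 F (suc n) E t m - + 𝒫 F (suc n) E t a * + 𝒫 F (suc n) E t b
                in c * c ≤ + (order ℕ.^ suc (suc n)) * (+ 𝒫 F (suc n) E t l * + 𝒫 F (suc n) E t l′)
      𝒫-bound t≢0 a b refl refl refl =
        ℤ.≤-trans (ℤ.≤-reflexive (cong (λ c → c * c) correlation))
          (ℤ.≤-trans (∑-cauchy-schwarz Pts (pathsFrom a) (discrepancy (pathsFrom b) t))
            (ℤ.≤-trans (ℤ.≤-reflexive (cong (_* energy (pathsFrom b) t) (∑-pathsFrom-* a a)))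
              (ℤ.≤-trans (ℤ.*-monoˡ-≤-nonNeg (P (a ℕ.+ a)) (energy-bound (pathsFrom b) t≢0))
                (ℤ.≤-reflexive regroup))))
        where
        Pts = allPoints (suc n)
        P : ℕ → ℤ
        P i = + 𝒫 F (suc n) E t i
        correlation : q * P (suc (a ℕ.+ b)) - P a * P b
                      ≡ ∑[ x ← Pts ] (pathsFrom a x * discrepancy (pathsFrom b) t x)
        correlation = sym (begin
          ∑[ x ← Pts ] (pathsFrom a x * (q * incidence (pathsFrom b) t x - S))
            ≡⟨ ∑-cong Pts (λ x → distribute (pathsFrom a x) q (incidence (pathsFrom b) t x) S) ⟩
          ∑[ x ← Pts ] (q * (pathsFrom a x * incidence (pathsFrom b) t x) - S * pathsFrom a x)
            ≡⟨ ∑-distrib-sub Pts _ _ ⟩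
          ∑[ x ← Pts ] (q * (pathsFrom a x * incidence (pathsFrom b) t x)) - ∑[ x ← Pts ] (S * pathsFrom a x)
            ≡⟨ cong₂ _-_ (∑-factorˡ Pts q _) (∑-factorˡ Pts S (pathsFrom a)) ⟩
          q * ∑[ x ← Pts ] (pathsFrom a x * incidence (pathsFrom b) t x) - S * ∑ Pts (pathsFrom a)
            ≡⟨ cong₂ (λ u v → q * u - v) adjacent
                     (cong₂ _*_ (sym (𝒫≡∑pathsFrom b)) (sym (𝒫≡∑pathsFrom a))) ⟩
          q * P (suc (a ℕ.+ b)) - P b * P a
            ≡⟨ cong (_-_ (q * P (suc (a ℕ.+ b)))) (ℤ.*-comm (P b) (P a)) ⟩
          q * P (suc (a ℕ.+ b)) - P a * P b ∎)
          where
          distribute : ∀ u q i p → u * (q * i - p) ≡ q * (u * i) - p * u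
          distribute = solve-∀
          S = ∑ Pts (pathsFrom b)
          adjacent : ∑[ x ← Pts ] (pathsFrom a x * incidence (pathsFrom b) t x) ≡ P (suc (a ℕ.+ b))
          adjacent = trans (∑-cong Pts (pathsFrom-*-incidence a b))
                           (trans (∑-pathsFrom-* a (suc b)) (cong P (ℕₚ.+-suc a b)))
        regroup : P (a ℕ.+ a) * (q ^ suc (suc n) * ∑[ x ← Pts ] (pathsFrom b x * pathsFrom b x))
                  ≡ + (order ℕ.^ suc (suc n)) * (P (a ℕ.+ a) * P (b ℕ.+ b))
        regroup = begin
          P (a ℕ.+ a) * (q ^ suc (suc n) * ∑[ x ← Pts ] (pathsFrom b x * pathsFrom b x))
            ≡⟨ cong (λ s → P (a ℕ.+ a) * (q ^ suc (suc n) * s)) (∑-pathsFrom-* b b) ⟩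
          P (a ℕ.+ a) * (q ^ suc (suc n) * P (b ℕ.+ b))
            ≡⟨ swap (P (a ℕ.+ a)) (q ^ suc (suc n)) (P (b ℕ.+ b)) ⟩
          q ^ suc (suc n) * (P (a ℕ.+ a) * P (b ℕ.+ b))
            ≡⟨ cong (_* (P (a ℕ.+ a) * P (b ℕ.+ b))) (sym (pos-^ order (suc (suc n)))) ⟩
          + (order ℕ.^ suc (suc n)) * (P (a ℕ.+ a) * P (b ℕ.+ b)) ∎
          where
          swap : ∀ u v w → u * (v * w) ≡ v * (u * w)
          swap = solve-∀

open import Defs
open import Data.Nat using (ℕ; suc; _≤_; _^_; _∸_) renaming (_*_ to _*ℕ_)
open import Data.Integer using (ℤ; +_; _-_) renaming (_*_ to _*ℤ_; _≤_ to _≤ℤ_)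
open import Data.Bool using (Bool)
open import Relation.Nullary using (¬_)
open import Relation.Binary.PropositionalEquality using (_≡_)
open import Data.Product using (_×_)

open import Data.Nat using (_+_; s≤s)
open import Data.Nat.Properties using (+-suc; +-identityʳ)
open import Data.Product using (_,_)
open import Relation.Binary.PropositionalEquality using (cong; sym; trans)

lemma2p1 : (F : FiniteField) (d : ℕ) → 2 ≤ d → (t : FiniteField.Carrier F) →
           ¬ (t ≡ FiniteField.0# F) → (E : Point F d → Bool) → (k : ℕ) → 1 ≤ k →
           let q = + FiniteField.order F
               P = λ n → + 𝒫 F d E t n
               A = q *ℤ P (suc (2 *ℕ k)) - P k *ℤ P k
               B = q *ℤ P (2 *ℕ k) - P k *ℤ P (k ∸ 1)
           in (A *ℤ A ≤ℤ (+ (FiniteField.order F ^ suc d)) *ℤ (P (2 *ℕ k) *ℤ P (2 *ℕ k)))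
              × (B *ℤ B ≤ℤ (+ (FiniteField.order F ^ suc d)) *ℤ (P (2 *ℕ k) *ℤ P (2 *ℕ k ∸ 2)))
lemma2p1 F (suc n) (s≤s _) t t≢0 E (suc j) (s≤s _) =
    𝒫-bound F E t t≢0 k k (cong suc double) double double
  , 𝒫-bound F E t t≢0 k j (trans (sym (+-suc k j)) double) double
                          (cong (_∸ 2) (trans (cong suc (sym (+-suc j j))) double))
  where
  k = suc j
  double : k + k ≡ 2 *ℕ k
  double = cong (_+_ k) (sym (+-identityʳ k))
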